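{- For every positive integer $\Delta\geq 15$ there is a connected bipartite graph $G$ with maximum degree $\Delta(G)=\Delta$ such that $G\notin\mathfrak{N}$.
   Context: All graphs are finite, without loops or multiple edges. An interval $t$-coloring of a graph $G$ is a proper edge-coloring of $G$ with colors $1,\ldots,t$ such that every color is used and for every vertex $v$ the set of colors of edges incident to $v$ is an interval of integers. $\mathfrak{N}$ denotes the set of graphs having an interval $t$-coloring for some positive integer $t$. -}

module Defs where

open import Data.Nat using (ℕ; zero; suc; _+_; _≤_; _⊔_)
open import Data.Fin using (Fin)
open import Data.List using (List; map; foldr; allFin)
open import Data.Nat.ListAction using (sum)
open import Data.Bool using (Bool; true; false; if_then_else_)
open import Data.Product using (Σ; ∃; ∃-syntax; _×_)
open import Relation.Binary.PropositionalEquality using (_≡_; _≢_)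
open import Relation.Binary.Construct.Closure.ReflexiveTransitive using (Star)

record Graph : Set where
  field
    n     : ℕ
    adj   : Fin n → Fin n → Bool
    sym   : ∀ u v → adj u v ≡ adj v u
    irref : ∀ v → adj v v ≡ false

module _ (G : Graph) where
  open Graph G

  Edge : Fin n → Fin n → Set
  Edge u v = adj u v ≡ true

  degree : Fin n → ℕ
  degree v = sum (map (λ w → if adj v w then 1 else 0) (allFin n))

  -- maximum degree Δ(G) (0 for the empty vertex set)
  maxDegree : ℕ
  maxDegree = foldr _⊔_ 0 (map degree (allFin n))

  Connected : Set
  Connected = ∀ u v → Star Edge u v

  Bipartite : Set
  Bipartite = Σ (Fin n → Bool) (λ side → ∀ u v → Edge u v → side u ≢ side v)

  -- an edge colouring is given by c u v = colour of edge uv (meaningful on edges only)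
  -- Interval t-colouring:
  record IntervalColoring (t : ℕ) (c : Fin n → Fin n → ℕ) : Set where
    field
      symmetric : ∀ u v → Edge u v → c u v ≡ c v u
      inRange   : ∀ u v → Edge u v → 1 ≤ c u v × c u v ≤ t
      proper    : ∀ u v w → Edge u v → Edge u w → v ≢ w → c u v ≢ c u w
      allUsed   : ∀ k → 1 ≤ k → k ≤ t → ∃[ u ] ∃[ v ] (Edge u v × c u v ≡ k)
      interval  : ∀ v a b k → a ≤ k → k ≤ b →
                  ∃[ w ] (Edge v w × c v w ≡ a) →
                  ∃[ w ] (Edge v w × c v w ≡ b) →
                  ∃[ w ] (Edge v w × c v w ≡ k)

  -- G ∈ 𝔑 : G has an interval t-colouring for some positive integer t
  InN : Set
  InN = ∃[ t ] (1 ≤ t × ∃[ c ] IntervalColoring t c)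

module Submission where

-- Writing D for Δ, pick Q with
-- 2Q + 7 ≤ D ≤ 4Q.  The graph has an apex joined to D vertices y_j, which
-- are split into four blocks of at most Q vertices; block g is joined to a
-- vertex x_g, and the four x_g are joined to a root.
--
-- Two facts about an interval colouring drive the proof:
--   * (span) if the neighbourhood of v is covered by a list of d vertices,
--     the colours at v differ pairwise by less than d;
--   * (window) D distinct natural numbers that differ pairwise by at most K
--     force D ≤ K + 1.
-- Walking around the 6-cycle apex, y_j, x_g, root, x_h, y_l, apex and applying
-- (span) at its five inner vertices bounds the difference of the colours of
-- apex–y_j and apex–y_l by 1 + Q + 3 + Q + 1 = 2Q + 5; (window) then gives
-- D ≤ 2Q + 6, contradicting 2Q + 7 ≤ D.

open import Defs
open import Data.Nat using (ℕ; zero; suc; _+_; _∸_; _≤_; _<_; _⊔_; _<?_; s≤s; z≤n; z<s; s≤s⁻¹; ⌊_/2⌋; ⌈_/2⌉)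
open import Data.Nat.Properties hiding (_≟_)
open import Data.Nat.ListAction using (sum)
open import Data.Nat.Tactic.RingSolver using (solve-∀)
open import Data.Fin using (Fin; toℕ; fromℕ<; _≟_) renaming (zero to fz; suc to fs)
import Data.Fin.Properties as Fin
open import Data.List using (List; []; _∷_; length; map; foldr; allFin; tabulate; applyUpTo; lookup)
open import Data.List.Properties using (map-tabulate; length-applyUpTo; foldr-preservesᵇ; foldr-preservesᵒ)
import Data.List.Relation.Unary.All as All
import Data.List.Relation.Unary.All.Properties as All
import Data.List.Relation.Unary.Any.Properties as Any
open import Data.List.Relation.Unary.Any using (index; here; there)
open import Data.List.Membership.Propositional using (_∈_)
open import Data.List.Membership.Propositional.Properties using (∈-allFin; ∈-map⁺; ∈-applyUpTo⁺)
open import Data.List.Extrema ≤-totalOrder using (argmin; f[argmin]≤f[xs])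
open import Data.Bool using (Bool; true; false; if_then_else_)
open import Data.Product using (Σ; ∃-syntax; _×_; _,_; proj₁; proj₂)
open import Data.Sum using (inj₂; [_,_])
open import Function using (_∘_)
open import Function.Definitions using (Injective)
open import Relation.Nullary using (¬_; Dec; yes; no; does; contradiction)
open import Relation.Nullary.Decidable using (dec-true; dec-false)
open import Relation.Binary.PropositionalEquality hiding ([_])
open import Relation.Binary.Construct.Closure.ReflexiveTransitive using (Star; ε; _◅_; _◅◅_; gmap; reverse)

module _ (G : Graph) where
  open Graph G using (n)

  edge-sym : ∀ {u v} → Edge G u v → Edge G v u
  edge-sym {u} {v} e = trans (Graph.sym G v u) e

  connected-via : (r : Fin n) → (∀ v → Star (Edge G) v r) → Connected G
  connected-via r to u v = to u ◅◅ reverse edge-sym (to v)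

  Covers : Fin n → List ℕ → Set
  Covers v L = ∀ w → Edge G v w → toℕ w ∈ L

  module _ {t : ℕ} {c : Fin n → Fin n → ℕ} (ic : IntervalColoring G t c) where
    open IntervalColoring ic

    -- Colours at v span fewer than length L values: otherwise the interval
    -- property yields length L + 1 edges at v with distinct colours, whose
    -- endpoints would be length L + 1 distinct members of L.
    span : ∀ {v L w₁ w₂} → Covers v L → Edge G v w₁ → Edge G v w₂ →
           c v w₂ < c v w₁ + length L
    span {v} {L} {w₁} {w₂} cov e₁ e₂ with c v w₂ <? c v w₁ + length L
    ... | yes lt = lt
    ... | no ≮ = contradiction (Fin.injective⇒≤ position-injective) 1+n≰n
      where
      a = c v w₁

      carrier : (k : Fin (suc (length L))) → ∃[ w ] (Edge G v w × c v w ≡ a + toℕ k)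
      carrier k = interval v a (c v w₂) (a + toℕ k) (m≤m+n a _)
        (≤-trans (+-monoʳ-≤ a (s≤s⁻¹ (Fin.toℕ<n k))) (≮⇒≥ ≮))
        (w₁ , e₁ , refl) (w₂ , e₂ , refl)

      carrier-in-L : ∀ k → toℕ (proj₁ (carrier k)) ∈ L
      carrier-in-L k = cov _ (proj₁ (proj₂ (carrier k)))

      position : Fin (suc (length L)) → Fin (length L)
      position k = index (carrier-in-L k)

      position-injective : Injective _≡_ _≡_ position
      position-injective {k} {k′} same = Fin.toℕ-injective (+-cancelˡ-≡ a _ _ (begin
        a + toℕ k                    ≡⟨ sym (proj₂ (proj₂ (carrier k))) ⟩
        c v (proj₁ (carrier k))      ≡⟨ cong (c v) same-carrier ⟩
        c v (proj₁ (carrier k′))     ≡⟨ proj₂ (proj₂ (carrier k′)) ⟩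
        a + toℕ k′                   ∎))
        where
        open ≡-Reasoning
        same-carrier : proj₁ (carrier k) ≡ proj₁ (carrier k′)
        same-carrier = Fin.toℕ-injective (begin
          toℕ (proj₁ (carrier k))      ≡⟨ Any.lookup-index (carrier-in-L k) ⟩
          lookup L (position k)        ≡⟨ cong (lookup L) same ⟩
          lookup L (position k′)       ≡⟨ sym (Any.lookup-index (carrier-in-L k′)) ⟩
          toℕ (proj₁ (carrier k′))     ∎)

    turn : ∀ {u v w L d} → Covers v L → length L ≡ suc d →
           Edge G u v → Edge G v w → c v w ≤ c u v + d
    turn {u} {v} {w} {L} {d} cov len e₁ e₂ = s≤s⁻¹ (begin-strict
      c v w              <⟨ span cov (edge-sym e₁) e₂ ⟩
      c v u + length L   ≡⟨ cong₂ _+_ (sym (symmetric u v e₁)) len ⟩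
      c u v + suc d      ≡⟨ +-suc (c u v) d ⟩
      suc (c u v + d)    ∎)
      where open ≤-Reasoning

-- Pigeonhole on a window: m distinct numbers differing pairwise by at most K
-- number at most K + 1 (shift by the minimum into Fin (suc K)).
window-bound : ∀ {m} K (f : Fin m → ℕ) → Injective _≡_ _≡_ f →
               (∀ i j → f j ≤ f i + K) → m ≤ suc K
window-bound {zero} K f f-inj spread = z≤n
window-bound {suc m} K f f-inj spread = Fin.injective⇒≤ shift-injective
  where
  low : Fin (suc m)
  low = argmin f fz (allFin (suc m))

  low-min : ∀ j → f low ≤ f j
  low-min j = All.lookup (f[argmin]≤f[xs] {f = f} fz (allFin (suc m))) (∈-allFin j)

  shift< : ∀ j → f j ∸ f low < suc K
  shift< j = s≤s (m≤n+o⇒m∸n≤o (f j) (f low) (spread low j))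

  shift : Fin (suc m) → Fin (suc K)
  shift j = fromℕ< (shift< j)

  shift-injective : Injective _≡_ _≡_ shift
  shift-injective {j} {k} same = f-inj (∸-cancelʳ-≡ (low-min j) (low-min k)
    (Fin.fromℕ<-injective _ _ (shift< j) (shift< k) same))

sum-ones : ∀ m → sum (tabulate {n = m} (λ _ → 1)) ≡ m
sum-ones zero = refl
sum-ones (suc m) = cong suc (sum-ones m)

sum-zeros : ∀ m → sum (tabulate {n = m} (λ _ → 0)) ≡ 0
sum-zeros zero = refl
sum-zeros (suc m) = sum-zeros m

sum-≤ : ∀ {m} (f : Fin m → ℕ) → (∀ i → f i ≤ 1) → sum (tabulate f) ≤ m
sum-≤ {zero} f f≤1 = z≤n
sum-≤ {suc m} f f≤1 = +-mono-≤ (f≤1 fz) (sum-≤ (f ∘ fs) (f≤1 ∘ fs))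

sum-< : ∀ {m} (f : Fin m → ℕ) → (∀ i → f i ≤ 1) → ∀ i → f i ≡ 0 → sum (tabulate f) < m
sum-< {suc m} f f≤1 fz f0≡0 rewrite f0≡0 = s≤s (sum-≤ (f ∘ fs) (f≤1 ∘ fs))
sum-< {suc m} f f≤1 (fs i) fi≡0 = begin-strict
  f fz + sum (tabulate (f ∘ fs))  <⟨ +-monoʳ-< (f fz) (sum-< (f ∘ fs) (f≤1 ∘ fs) i fi≡0) ⟩
  f fz + m                        ≤⟨ +-monoˡ-≤ m (f≤1 fz) ⟩
  suc m                           ∎
  where open ≤-Reasoning

max-attained : ∀ {m} (f : Fin m → ℕ) D → (∀ i → f i ≤ D) → ∀ i → f i ≡ D →
               foldr _⊔_ 0 (map f (allFin m)) ≡ D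
max-attained f D bounded i attained = ≤-antisym
  (foldr-preservesᵇ {P = _≤ D} {f = _⊔_} ⊔-lub z≤n (All.map⁺ (All.tabulate⁺ bounded)))
  (foldr-preservesᵒ {P = D ≤_} {f = _⊔_} (λ x y → [ m≤n⇒m≤n⊔o y , m≤n⇒m≤o⊔n x ]) 0 _
    (inj₂ (Any.map⁺ (Any.tabulate⁺ i (≤-reflexive (sym attained))))))

-- Choosing the block size: for D = 15 + r, Q = 4 + ⌊r/2⌋ satisfies
-- 2Q + 7 ≤ D ≤ 4Q.  This is where the bound 15 enters.
block-size : ∀ r → ∃[ Q ] (1 ≤ Q × Q + Q + 7 ≤ 15 + r × 15 + r ≤ Q + Q + Q + Q)
block-size r = 4 + h , s≤s z≤n , lower , upper
  where
  open ≤-Reasoning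
  h = ⌊ r /2⌋
  c = ⌈ r /2⌉

  halves : h + c ≡ r
  halves = ⌊n/2⌋+⌈n/2⌉≡n r

  lower : 4 + h + (4 + h) + 7 ≤ 15 + r
  lower = begin
    4 + h + (4 + h) + 7  ≡⟨ regroup h ⟩
    15 + (h + h)         ≤⟨ +-monoʳ-≤ 15 (+-monoʳ-≤ h (⌊n/2⌋≤⌈n/2⌉ r)) ⟩
    15 + (h + c)         ≡⟨ cong (15 +_) halves ⟩
    15 + r               ∎
    where
    regroup : ∀ h → 4 + h + (4 + h) + 7 ≡ 15 + (h + h)
    regroup = solve-∀

  upper : 15 + r ≤ 4 + h + (4 + h) + (4 + h) + (4 + h)
  upper = begin
    15 + r                         ≡⟨ cong (15 +_) (sym halves) ⟩
    15 + (h + c)                   ≤⟨ +-monoʳ-≤ 15 (+-monoʳ-≤ h c≤1+h) ⟩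
    15 + (h + suc h)               ≤⟨ m≤m+n _ (h + h) ⟩
    15 + (h + suc h) + (h + h)     ≡⟨ regroup h ⟩
    4 + h + (4 + h) + (4 + h) + (4 + h) ∎
    where
    -- ⌈r/2⌉ = ⌊(r+1)/2⌋ ≤ ⌊(r+2)/2⌋ = 1 + ⌊r/2⌋
    c≤1+h : c ≤ suc h
    c≤1+h = ⌊n/2⌋-mono (n≤1+n (suc r))

    regroup : ∀ h → 15 + (h + suc h) + (h + h) ≡ 4 + h + (4 + h) + (4 + h) + (4 + h)
    regroup = solve-∀

decided : ∀ {A : Set} (a? : Dec A) → does a? ≡ true → A
decided (yes a) _ = a

ind : Bool → ℕ
ind b = if b then 1 else 0

ind≤1 : ∀ b → ind b ≤ 1
ind≤1 true = ≤-refl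
ind≤1 false = z≤n

Counterexample : ℕ → Set
Counterexample D = Σ Graph (λ G → Connected G × Bipartite G × maxDegree G ≡ D × ¬ InN G)

module Construction (D Q : ℕ) (1≤Q : 1 ≤ Q) (lower : Q + Q + 7 ≤ D)
                    (upper : D ≤ Q + Q + Q + Q) where

  data Vertex : Set where
    apex root : Vertex
    x : Fin 4 → Vertex
    y : Fin D → Vertex

  block : ℕ → Fin 4
  block i with i <? Q | i <? Q + Q | i <? Q + Q + Q
  ... | yes _ | _     | _     = fz
  ... | no _  | yes _ | _     = fs fz
  ... | no _  | no _  | yes _ = fs (fs fz)
  ... | no _  | no _  | no _  = fs (fs (fs fz))

  start : Fin 4 → ℕ
  start fz = 0
  start (fs fz) = Q
  start (fs (fs fz)) = Q + Q
  start (fs (fs (fs fz))) = Q + Q + Q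

  block-range : ∀ i → i < D → start (block i) ≤ i × i < start (block i) + Q
  block-range i i<D with i <? Q | i <? Q + Q | i <? Q + Q + Q
  ... | yes i<Q | _      | _      = z≤n , i<Q
  ... | no i≮Q  | yes lt | _      = ≮⇒≥ i≮Q , lt
  ... | no _    | no i≮  | yes lt = ≮⇒≥ i≮ , lt
  ... | no _    | no _   | no i≮  = ≮⇒≥ i≮ , ≤-trans i<D upper

  block-0 : block 0 ≡ fz
  block-0 with 0 <? Q
  ... | yes _ = refl
  ... | no 0≮Q = contradiction 1≤Q 0≮Q

  block-Q : block Q ≡ fs fz
  block-Q with Q <? Q | Q <? Q + Q
  ... | yes Q<Q | _   = contradiction Q<Q (n≮n Q)
  ... | no _ | yes _  = refl
  ... | no _ | no Q≮  = contradiction (subst (_< Q + Q) (+-identityʳ Q) (+-monoʳ-< Q 1≤Q)) Q≮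

  blockOf : Fin D → Fin 4
  blockOf j = block (toℕ j)

  adjacent : Vertex → Vertex → Bool
  adjacent apex (y _) = true
  adjacent root (x _) = true
  adjacent (x _) root = true
  adjacent (x g) (y j) = does (blockOf j ≟ g)
  adjacent (y j) (x g) = does (blockOf j ≟ g)
  adjacent (y _) apex = true
  adjacent _ _ = false

  adjacent-sym : ∀ u v → adjacent u v ≡ adjacent v u
  adjacent-sym apex apex = refl
  adjacent-sym apex root = refl
  adjacent-sym apex (x _) = refl
  adjacent-sym apex (y _) = refl
  adjacent-sym root apex = refl
  adjacent-sym root root = refl
  adjacent-sym root (x _) = refl
  adjacent-sym root (y _) = refl
  adjacent-sym (x _) apex = refl
  adjacent-sym (x _) root = refl
  adjacent-sym (x _) (x _) = refl
  adjacent-sym (x _) (y _) = refl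
  adjacent-sym (y _) apex = refl
  adjacent-sym (y _) root = refl
  adjacent-sym (y _) (x _) = refl
  adjacent-sym (y _) (y _) = refl

  adjacent-irrefl : ∀ v → adjacent v v ≡ false
  adjacent-irrefl apex = refl
  adjacent-irrefl root = refl
  adjacent-irrefl (x _) = refl
  adjacent-irrefl (y _) = refl

  side : Vertex → Bool
  side apex = false
  side root = true
  side (x _) = false
  side (y _) = true

  side-proper : ∀ u v → adjacent u v ≡ true → side u ≢ side v
  side-proper apex (y _) _ ()
  side-proper root (x _) _ ()
  side-proper (x _) root _ ()
  side-proper (x _) (y _) _ ()
  side-proper (y _) (x _) _ ()
  side-proper (y _) apex _ ()

  decode : Fin (6 + D) → Vertex
  decode fz = apex
  decode (fs fz) = root
  decode (fs (fs fz)) = x fz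
  decode (fs (fs (fs fz))) = x (fs fz)
  decode (fs (fs (fs (fs fz)))) = x (fs (fs fz))
  decode (fs (fs (fs (fs (fs fz))))) = x (fs (fs (fs fz)))
  decode (fs (fs (fs (fs (fs (fs j)))))) = y j

  encode : Vertex → Fin (6 + D)
  encode apex = fz
  encode root = fs fz
  encode (x fz) = fs (fs fz)
  encode (x (fs fz)) = fs (fs (fs fz))
  encode (x (fs (fs fz))) = fs (fs (fs (fs fz)))
  encode (x (fs (fs (fs fz)))) = fs (fs (fs (fs (fs fz))))
  encode (y j) = fs (fs (fs (fs (fs (fs j)))))

  decode-encode : ∀ v → decode (encode v) ≡ v
  decode-encode apex = refl
  decode-encode root = refl
  decode-encode (x fz) = refl
  decode-encode (x (fs fz)) = refl
  decode-encode (x (fs (fs fz))) = refl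
  decode-encode (x (fs (fs (fs fz)))) = refl
  decode-encode (y _) = refl

  encode-decode : ∀ i → encode (decode i) ≡ i
  encode-decode fz = refl
  encode-decode (fs fz) = refl
  encode-decode (fs (fs fz)) = refl
  encode-decode (fs (fs (fs fz))) = refl
  encode-decode (fs (fs (fs (fs fz)))) = refl
  encode-decode (fs (fs (fs (fs (fs fz))))) = refl
  encode-decode (fs (fs (fs (fs (fs (fs _)))))) = refl

  G : Graph
  G = record
    { n     = 6 + D
    ; adj   = λ i k → adjacent (decode i) (decode k)
    ; sym   = λ i k → adjacent-sym (decode i) (decode k)
    ; irref = λ i → adjacent-irrefl (decode i)
    }

  Adjacent : Vertex → Vertex → Set
  Adjacent u v = adjacent u v ≡ true

  edge : ∀ u v → Adjacent u v → Edge G (encode u) (encode v)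
  edge u v e = subst₂ Adjacent (sym (decode-encode u)) (sym (decode-encode v)) e

  x-y : ∀ j → Adjacent (x (blockOf j)) (y j)
  x-y j = dec-true (blockOf j ≟ blockOf j) refl

  y-x : ∀ j → Adjacent (y j) (x (blockOf j))
  y-x j = dec-true (blockOf j ≟ blockOf j) refl

  D>Q : Q < D
  D>Q = <-≤-trans (≤-<-trans (m≤m+n Q Q) (m<m+n (Q + Q) z<s)) lower

  y₀ y₁ : Fin D
  y₀ = fromℕ< (≤-trans (s≤s z≤n) D>Q)
  y₁ = fromℕ< D>Q

  y₀-block : blockOf y₀ ≡ fz
  y₀-block = trans (cong block (Fin.toℕ-fromℕ< _)) block-0

  y₁-block : blockOf y₁ ≡ fs fz
  y₁-block = trans (cong block (Fin.toℕ-fromℕ< D>Q)) block-Q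

  -- A walk step with its next vertex named (adjacency facts reduce to
  -- true ≡ true, which does not determine the vertices).
  step : ∀ {u} v {w} → Adjacent u v → Star Adjacent v w → Star Adjacent u w
  step v e walk = e ◅ walk

  x₀-y₀ : Adjacent (x fz) (y y₀)
  x₀-y₀ = dec-true (blockOf y₀ ≟ fz) y₀-block

  to-apex : ∀ v → Star Adjacent v apex
  to-apex apex = ε
  to-apex root = step (x fz) refl (step (y y₀) x₀-y₀ (step apex refl ε))
  to-apex (x g) = step root refl (to-apex root)
  to-apex (y j) = step apex refl ε

  connected : Connected G
  connected = connected-via G (encode apex) λ i →
    subst (λ k → Star (Edge G) k (encode apex)) (encode-decode i)
          (gmap encode (λ {u} {v} → edge u v) (to-apex (decode i)))

  bipartite : Bipartite G
  bipartite = side ∘ decode , λ i k → side-proper (decode i) (decode k)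

  yCount : Vertex → ℕ
  yCount v = sum (tabulate (λ j → ind (adjacent v (y j))))

  -- degreeV v counts the neighbours of v in the vertex order of decode.
  degreeV : Vertex → ℕ
  degreeV v = ind (adjacent v apex) + (ind (adjacent v root) +
    (ind (adjacent v (x fz)) + (ind (adjacent v (x (fs fz))) +
    (ind (adjacent v (x (fs (fs fz)))) + (ind (adjacent v (x (fs (fs (fs fz))))) +
    yCount v)))))

  degree-decode : ∀ i → degree G i ≡ degreeV (decode i)
  degree-decode i = cong sum (map-tabulate (λ k → k) (λ k → ind (adjacent (decode i) (decode k))))

  7≤D : 7 ≤ D
  7≤D = ≤-trans (m≤n+m 7 (Q + Q)) lower

  outside : ∀ g → ∃[ j ] (blockOf j ≢ g)
  outside fz = y₁ , λ e → Fin.0≢1+n (sym (trans (sym y₁-block) e))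
  outside (fs g) = y₀ , λ e → Fin.0≢1+n (trans (sym y₀-block) e)

  degreeV-≤ : ∀ v → degreeV v ≤ D
  degreeV-≤ apex = ≤-reflexive (sum-ones D)
  degreeV-≤ root = ≤-trans (≤-reflexive (cong (4 +_) (sum-zeros D))) (≤-trans (m≤n+m 4 3) 7≤D)
  degreeV-≤ (x g) = sum-< (λ j → ind (does (blockOf j ≟ g))) (λ _ → ind≤1 _) j
                       (cong ind (dec-false (blockOf j ≟ g) (proj₂ (outside g))))
    where j = proj₁ (outside g)
  degreeV-≤ (y j) = ≤-trans (s≤s (+-mono-≤ (to-x fz) (+-mono-≤ (to-x (fs fz))
    (+-mono-≤ (to-x (fs (fs fz))) (+-mono-≤ (to-x (fs (fs (fs fz)))) (≤-reflexive (sum-zeros D)))))))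
    (≤-trans (m≤n+m 5 2) 7≤D)
    where
    to-x : ∀ g → ind (adjacent (y j) (x g)) ≤ 1
    to-x g = ind≤1 (adjacent (y j) (x g))

  max-degree : maxDegree G ≡ D
  max-degree = max-attained (degree G) D
    (λ i → ≤-trans (≤-reflexive (degree-decode i)) (degreeV-≤ (decode i)))
    fz (trans (degree-decode fz) (sum-ones D))

  lift-covers : ∀ v L → (∀ w → Adjacent v w → toℕ (encode w) ∈ L) → Covers G (encode v) L
  lift-covers v L cov i e = subst (λ k → toℕ k ∈ L) (encode-decode i)
    (cov (decode i) (subst (λ u → Adjacent u (decode i)) (decode-encode v) e))

  rootList : List ℕ
  rootList = map (toℕ ∘ encode ∘ x) (allFin 4)

  blockList : Fin 4 → List ℕ
  blockList g = applyUpTo (λ i → 6 + (start g + i)) Q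

  xList : Fin 4 → List ℕ
  xList g = toℕ (encode root) ∷ blockList g

  yList : Fin D → List ℕ
  yList j = toℕ (encode apex) ∷ toℕ (encode (x (blockOf j))) ∷ []

  y-in-block : ∀ j → toℕ (encode (y j)) ∈ blockList (blockOf j)
  y-in-block j = subst (_∈ blockList (blockOf j)) (cong (6 +_) (m+[n∸m]≡n low))
    (∈-applyUpTo⁺ (λ i → 6 + (s + i))
      (+-cancelˡ-< s _ _ (subst (_< s + Q) (sym (m+[n∸m]≡n low)) high)))
    where
    s = start (blockOf j)
    low = proj₁ (block-range (toℕ j) (Fin.toℕ<n j))
    high = proj₂ (block-range (toℕ j) (Fin.toℕ<n j))

  root-covers : Covers G (encode root) rootList
  root-covers = lift-covers root rootList λ { (x g) _ → ∈-map⁺ (toℕ ∘ encode ∘ x) (∈-allFin g) }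

  x-covers : ∀ g → Covers G (encode (x g)) (xList g)
  x-covers g = lift-covers (x g) (xList g) λ
    { root _ → here refl
    ; (y j) e → there (subst (λ h → toℕ (encode (y j)) ∈ blockList h)
                             (decided (blockOf j ≟ g) e) (y-in-block j)) }

  y-covers : ∀ j → Covers G (encode (y j)) (yList j)
  y-covers j = lift-covers (y j) (yList j) λ
    { apex _ → here refl
    ; (x g) e → there (here (cong (toℕ ∘ encode ∘ x) (sym (decided (blockOf j ≟ g) e)))) }

  -- The spread 1 + Q + 3 + Q + 1 of the colours at the apex.
  K : ℕ
  K = Q + Q + 5

  module _ {t : ℕ} {c : Fin (6 + D) → Fin (6 + D) → ℕ} (ic : IntervalColoring G t c) where
    open IntervalColoring ic

    colour : Vertex → Vertex → ℕ
    colour u v = c (encode u) (encode v)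

    -- Colour growth through y_j (2 neighbours), x_g (≤ Q + 1) and root (4).
    through-y : ∀ {u w} j → Adjacent u (y j) → Adjacent (y j) w → colour (y j) w ≤ colour u (y j) + 1
    through-y {u} {w} j e₁ e₂ = turn G ic (y-covers j) refl (edge u (y j) e₁) (edge (y j) w e₂)

    through-x : ∀ {u w} g → Adjacent u (x g) → Adjacent (x g) w → colour (x g) w ≤ colour u (x g) + Q
    through-x {u} {w} g e₁ e₂ = turn G ic (x-covers g) (cong suc (length-applyUpTo _ Q))
                                  (edge u (x g) e₁) (edge (x g) w e₂)

    through-root : ∀ {u w} → Adjacent u root → Adjacent root w → colour root w ≤ colour u root + 3
    through-root {u} {w} e₁ e₂ = turn G ic root-covers refl (edge u root e₁) (edge root w e₂)

    apex-window : ∀ l j → colour apex (y j) ≤ colour apex (y l) + K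
    apex-window l j = begin
      colour apex (y j)                      ≡⟨ symmetric (encode apex) (encode (y j)) refl ⟩
      colour (y j) apex                      ≤⟨ at-yj ⟩
      colour (x g) (y j) + 1                 ≤⟨ +-monoˡ-≤ 1 at-xg ⟩
      colour root (x g) + Q + 1              ≤⟨ +-monoˡ-≤ 1 (+-monoˡ-≤ Q at-root) ⟩
      colour (x h) root + 3 + Q + 1          ≤⟨ +-monoˡ-≤ 1 (+-monoˡ-≤ Q (+-monoˡ-≤ 3 at-xh)) ⟩
      colour (y l) (x h) + Q + 3 + Q + 1     ≤⟨ +-monoˡ-≤ 1 (+-monoˡ-≤ Q (+-monoˡ-≤ 3 (+-monoˡ-≤ Q at-yl))) ⟩
      colour apex (y l) + 1 + Q + 3 + Q + 1  ≡⟨ regroup (colour apex (y l)) Q ⟩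
      colour apex (y l) + K                  ∎
      where
      open ≤-Reasoning
      g = blockOf j
      h = blockOf l

      at-yj : colour (y j) apex ≤ colour (x g) (y j) + 1
      at-yj = through-y {u = x g} {w = apex} j (x-y j) refl
      at-xg : colour (x g) (y j) ≤ colour root (x g) + Q
      at-xg = through-x {u = root} {w = y j} g refl (x-y j)
      at-root : colour root (x g) ≤ colour (x h) root + 3
      at-root = through-root {u = x h} {w = x g} refl refl
      at-xh : colour (x h) root ≤ colour (y l) (x h) + Q
      at-xh = through-x {u = y l} {w = root} h (y-x l) refl
      at-yl : colour (y l) (x h) ≤ colour apex (y l) + 1
      at-yl = through-y {u = apex} {w = x h} l refl (y-x l)

      regroup : ∀ a Q → a + 1 + Q + 3 + Q + 1 ≡ a + (Q + Q + 5)
      regroup = solve-∀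

    apex-injective : Injective _≡_ _≡_ (λ j → colour apex (y j))
    apex-injective {j} {l} same with j ≟ l
    ... | yes j≡l = j≡l
    ... | no j≢l = contradiction same
      (proper (encode apex) (encode (y j)) (encode (y l)) refl refl (j≢l ∘ y-injective ∘ cong decode))
      where
      y-injective : y j ≡ y l → j ≡ l
      y-injective refl = refl

  not-interval : ¬ InN G
  not-interval (t , _ , c , ic) = 1+n≰n (begin
    suc (suc K)   ≡⟨ regroup Q ⟩
    Q + Q + 7     ≤⟨ lower ⟩
    D             ≤⟨ window-bound K _ (apex-injective ic) (apex-window ic) ⟩
    suc K         ∎)
    where
    open ≤-Reasoning
    regroup : ∀ Q → suc (suc (Q + Q + 5)) ≡ Q + Q + 7
    regroup = solve-∀

  counterexample : Counterexample D
  counterexample = G , connected , bipartite , max-degree , not-interval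

counterexample-15+ : ∀ r → Counterexample (15 + r)
counterexample-15+ r with block-size r
... | Q , 1≤Q , lower , upper = Construction.counterexample (15 + r) Q 1≤Q lower upper

corollary1 : ∀ Δ → 15 ≤ Δ →
    Σ Graph (λ G → Connected G × Bipartite G × maxDegree G ≡ Δ × ¬ InN G)
corollary1 Δ 15≤Δ = subst Counterexample (m+[n∸m]≡n 15≤Δ) (counterexample-15+ (Δ ∸ 15))
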